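{- Let $G$ be an impartial SP-game whose impartial legal complex $\Delta=\Delta^{\mathrm{I}}_G$ is the disjoint union of pure simplicial complexes $\Delta_1,\dots,\Delta_k$ ($k\ge 1$) of dimensions $d_1,\dots,d_k$. Then $G$ has value $0$ if all $d_i$ are odd, value $*$ if all $d_i$ are even, and value $*2$ otherwise.
   Context: Games are short combinatorial games under normal play (a player unable to move loses). An SP-game is a placement game on an initially empty board in which pieces are placed on empty vertices, never moved or removed, and in which any sequence of moves leading to a reachable position consists of legal moves. A game is impartial if both players always have the same options. A basic position is a position with a single piece placed. For an impartial SP-game $G$, the impartial legal complex $\Delta^{\mathrm{I}}_G$ is the simplicial complex with one vertex per basic position, whose faces are the sets of vertices whose basic positions together form a legal position; a move from the position corresponding to face $F$ is to $F\cup\{v\}$ for a vertex $v\notin F$ with $F\cup\{v\}$ a face. A simplicial complex is pure if all its facets (maximal faces) have the same size; its dimension is the maximum face size minus one. The disjoint union of complexes on disjoint vertex sets has as faces the faces of each of them. Nimbers: $*0=0=\{\,\mid\,\}$, $*=*1=\{0\mid 0\}$, $*2=\{0,*\mid 0,*\}$. -}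

module Defs where

open import Data.Nat.Base using (ℕ; zero; suc; _≡ᵇ_; parity)
open import Data.Parity.Base using (Parity; 0ℙ; 1ℙ)
open import Data.Bool.Base using (Bool; true; false; T; not; _∧_; if_then_else_)
open import Data.Fin.Base using (Fin)
open import Data.Fin.Subset using (Subset; ⊥; ⁅_⁆; _∪_; _∈_; _∉_; _⊆_; ∣_∣)
open import Data.List.Base using (List; []; _∷_; map; filterᵇ; length)
open import Data.Bool.ListAction using (any)
open import Data.List.Base using () renaming (allFin to allFinL)
open import Data.Vec.Base using (lookup)
open import Data.Product.Base using (_×_; ∃-syntax)
open import Relation.Binary.PropositionalEquality using (_≡_)

-- Simplicial complexes on the vertex set Fin n.
-- Faces are given by a Boolean predicate (so the induced game is computable).

record SimplicialComplex (n : ℕ) : Set where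
  field
    face      : Subset n → Bool
    emptyFace : T (face ⊥)
    vertexFace : (v : Fin n) → T (face ⁅ v ⁆)
    downClosed : (F E : Subset n) → E ⊆ F → T (face F) → T (face E)

open SimplicialComplex public

IsFace : {n : ℕ} → SimplicialComplex n → Subset n → Set
IsFace Δ F = T (face Δ F)

-- The component Δ_i is the subcomplex of
-- faces of Δ all of whose vertices lie in part i.  Δ is the disjoint union
-- of Δ_1, …, Δ_k iff every face of Δ is a face of some Δ_i.

InPart : {n k : ℕ} → (Fin n → Fin k) → Fin k → Subset n → Set
InPart part i F = ∀ {v} → v ∈ F → part v ≡ i

IsDisjointUnion : {n k : ℕ} → SimplicialComplex n → (Fin n → Fin k) → Set
IsDisjointUnion {n} {k} Δ part =
  (F : Subset n) → IsFace Δ F → ∃[ i ] InPart part i F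

IsComponentFace : {n k : ℕ} → SimplicialComplex n → (Fin n → Fin k) →
                  Fin k → Subset n → Set
IsComponentFace Δ part i F = IsFace Δ F × InPart part i F

IsComponentFacet : {n k : ℕ} → SimplicialComplex n → (Fin n → Fin k) →
                   Fin k → Subset n → Set
IsComponentFacet {n} Δ part i F =
  IsComponentFace Δ part i F ×
  ((v : Fin n) → v ∉ F → IsComponentFace Δ part i (F ∪ ⁅ v ⁆) → Data.Empty.⊥)
  where import Data.Empty

-- Δ_i is pure of dimension d: every facet of Δ_i has d + 1 vertices.
-- (Since d : ℕ, this forces Δ_i to be nonempty, i.e. dimension ≥ 0.)
IsPureComponentOfDim : {n k : ℕ} → SimplicialComplex n → (Fin n → Fin k) →
                       Fin k → ℕ → Set
IsPureComponentOfDim {n} Δ part i d =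
  (F : Subset n) → IsComponentFacet Δ part i F → ∣ F ∣ ≡ suc d

-- The impartial game played on the legal complex: positions are faces,
-- a move from F is to F ∪ {v} with v ∉ F and F ∪ {v} a face.
-- Its value is the nimber *g where g is the Grundy value (Sprague–Grundy).

mex : List ℕ → ℕ
mex l = search 0 (suc (length l))
  where
    search : ℕ → ℕ → ℕ
    search m zero    = m
    search m (suc f) = if any (m ≡ᵇ_) l then search (suc m) f else m

moves : {n : ℕ} → SimplicialComplex n → Subset n → List (Fin n)
moves {n} Δ F = filterᵇ (λ v → not (lookup F v) ∧ face Δ (F ∪ ⁅ v ⁆)) (allFinL n)

-- Grundy value with fuel; each move adds a new vertex, so fuel n suffices
-- starting from any position.
grundyFuel : {n : ℕ} → SimplicialComplex n → ℕ → Subset n → ℕ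
grundyFuel Δ zero    F = 0
grundyFuel Δ (suc f) F = mex (map (λ v → grundyFuel Δ f (F ∪ ⁅ v ⁆)) (moves Δ F))

gameValue : {n : ℕ} → SimplicialComplex n → ℕ
gameValue {n} Δ = grundyFuel Δ n ⊥

Odd Even : ℕ → Set
Odd d  = parity d ≡ 1ℙ
Even d = parity d ≡ 0ℙ

{-# OPTIONS --safe #-}
-- Inside a pure component of dimension d every face lies in a facet with d + 1
-- vertices, and by disjointness every move from a nonempty face stays in its
-- component; so from a face F the game lasts exactly d + 1 - |F| moves however it
-- is played, and its Grundy value is the parity of that number.  The first move
-- picks a vertex of some component Δᵢ, reaching value parity dᵢ, and every
-- component has a vertex, so the value of G is the mex of {parity dᵢ}.
module Submission where

open import Defs
open import Data.Bool.Base using (true; false; not; _∧_; T)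
open import Data.Bool.ListAction using (any)
open import Data.Bool.Properties using (T-≡; T-∧; T-not-≡; ¬-not)
open import Data.Fin.Base using (Fin; zero; suc)
open import Data.Fin.Properties using (any?; ¬∀⟶∃¬) renaming (_≟_ to _≟ᶠ_)
open import Data.Fin.Subset
  using (Subset; ⊥; ⁅_⁆; _∪_; _∈_; _∉_; _⊆_; ∣_∣; Nonempty; inside; outside)
open import Data.Fin.Subset.Properties
  using (_∈?_; ∉⊥; ∣⊥∣≡0; ∣p∣≤n; ∪-identityˡ; ∪-identityʳ; x∈⁅x⁆; x∈⁅y⁆⇒x≡y;
         x∈p∪q⁺; x∈p∪q⁻; p⊆p∪q; ⊆-refl; ⊆-trans; p⊆q⇒∣p∣≤∣q∣; nonempty?; Empty-unique)
open import Data.List.Base using (List; []; _∷_; map; allFin)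
open import Data.List.Membership.Propositional using () renaming (_∈_ to _∈ₗ_; _∉_ to _∉ₗ_)
open import Data.List.Membership.Propositional.Properties
  using (∈-map⁺; ∈-map⁻; ∈-filter⁺; ∈-filter⁻; ∈-allFin)
open import Data.List.Relation.Unary.Any as Any using (here; there)
open import Data.List.Relation.Unary.Any.Properties using (any⁺; any⁻)
open import Data.Nat.Base using (ℕ; zero; suc; pred; _+_; _≤_; _<_; _≥_; _≡ᵇ_; parity; s≤s)
open import Data.Nat.Properties
  using (≡ᵇ⇒≡; ≡⇒≡ᵇ; +-suc; +-identityʳ; m+1+n≢m; 1+n≰n; ≤⇒≯; m≤m+n; <⇒≤pred)
open import Data.Parity.Base using (Parity; 0ℙ; 1ℙ; _⁻¹)
open import Data.Parity.Properties using (suc-homo-⁻¹; ⁻¹-selfInverse) renaming (_≟_ to _≟ℙ_)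
open import Data.Product.Base using (_×_; _,_; proj₁; proj₂; ∃-syntax)
open import Data.Sum.Base using (_⊎_; inj₁; inj₂)
open import Data.Vec.Base using (lookup; _∷_; here; there)
open import Data.Vec.Properties using (lookup⇒[]=; []=⇒lookup)
open import Function.Base using (_∘_)
open import Function.Bundles using (module Equivalence)
open import Relation.Nullary using (¬_; Dec; yes; no; contradiction)
open import Relation.Nullary.Decidable using (_×-dec_; ¬?)
open import Relation.Nullary.Decidable.Core using (T?)
open import Relation.Binary.PropositionalEquality
  using (_≡_; _≢_; refl; sym; trans; cong; subst; subst₂; module ≡-Reasoning)

toℕ : Parity → ℕ
toℕ 0ℙ = 0
toℕ 1ℙ = 1

≢⁻¹⇒≡ : ∀ {p q} → p ≢ q ⁻¹ → p ≡ q
≢⁻¹⇒≡ {0ℙ} {0ℙ} _ = refl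
≢⁻¹⇒≡ {0ℙ} {1ℙ} p≢q⁻¹ = contradiction refl p≢q⁻¹
≢⁻¹⇒≡ {1ℙ} {0ℙ} p≢q⁻¹ = contradiction refl p≢q⁻¹
≢⁻¹⇒≡ {1ℙ} {1ℙ} _ = refl

2≢toℕ : ∀ p → 2 ≢ toℕ p
2≢toℕ 0ℙ ()
2≢toℕ 1ℙ ()

parity-suc : ∀ m → parity m ⁻¹ ≡ parity (suc m)
parity-suc m = ⁻¹-selfInverse (suc-homo-⁻¹ m)

module _ {m : ℕ} {l : List ℕ} where

  any-≡ᵇ-true : m ∈ₗ l → any (m ≡ᵇ_) l ≡ true
  any-≡ᵇ-true m∈l = Equivalence.to T-≡ (any⁺ _ (Any.map (≡⇒≡ᵇ _ _) m∈l))

  any-≡ᵇ-false : m ∉ₗ l → any (m ≡ᵇ_) l ≡ false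
  any-≡ᵇ-false m∉l = ¬-not (m∉l ∘ Any.map (≡ᵇ⇒≡ _ _) ∘ any⁻ _ _ ∘ Equivalence.from T-≡)

mex≡0 : ∀ {l} → 0 ∉ₗ l → mex l ≡ 0
mex≡0 0∉l rewrite any-≡ᵇ-false 0∉l = refl

-- mex l searches with fuel 1 + length l; the patterns on l make that fuel visible.
mex≡1 : ∀ {l} → 0 ∈ₗ l → 1 ∉ₗ l → mex l ≡ 1
mex≡1 {x ∷ l} 0∈l 1∉l rewrite any-≡ᵇ-true 0∈l | any-≡ᵇ-false 1∉l = refl

mex≡2 : ∀ {l} → 0 ∈ₗ l → 1 ∈ₗ l → 2 ∉ₗ l → mex l ≡ 2
mex≡2 {_ ∷ []} (here refl) (here ()) _
mex≡2 {_ ∷ []} (there ()) _ _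
mex≡2 {_ ∷ []} _ (there ()) _
mex≡2 {_ ∷ _ ∷ _} 0∈l 1∈l 2∉l
  rewrite any-≡ᵇ-true 0∈l | any-≡ᵇ-true 1∈l | any-≡ᵇ-false 2∉l = refl

mex-constant : ∀ {p l x} → x ∈ₗ l → (∀ {y} → y ∈ₗ l → y ≡ toℕ p) → mex l ≡ toℕ (p ⁻¹)
mex-constant {0ℙ} x∈l all≡0 =
  mex≡1 (subst (_∈ₗ _) (all≡0 x∈l) x∈l) (λ 1∈l → contradiction (all≡0 1∈l) λ ())
mex-constant {1ℙ} _   all≡1 = mex≡0 (λ 0∈l → contradiction (all≡1 0∈l) λ ())

module ParityImage {k : ℕ} {l : List ℕ} (P : Fin (suc k) → Parity)
  (image⁻ : ∀ {x} → x ∈ₗ l → ∃[ i ] x ≡ toℕ (P i))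
  (image⁺ : ∀ i → toℕ (P i) ∈ₗ l) where

  private
    mex-allEqual : ∀ p → (∀ i → P i ≡ p) → mex l ≡ toℕ (p ⁻¹)
    mex-allEqual p all≡p = mex-constant (image⁺ zero)
      λ x∈l → let (i , x≡) = image⁻ x∈l in trans x≡ (cong toℕ (all≡p i))

    ∈-image : ∀ p → ¬ (∀ i → P i ≡ p ⁻¹) → toℕ p ∈ₗ l
    ∈-image p notAll = let (i , Pi≢) = ¬∀⟶∃¬ _ _ (λ i → P i ≟ℙ p ⁻¹) notAll
                       in subst (λ q → toℕ q ∈ₗ l) (≢⁻¹⇒≡ Pi≢) (image⁺ i)

  mex-allOdd : (∀ i → P i ≡ 1ℙ) → mex l ≡ 0
  mex-allOdd = mex-allEqual 1ℙ

  mex-allEven : (∀ i → P i ≡ 0ℙ) → mex l ≡ 1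
  mex-allEven = mex-allEqual 0ℙ

  mex-mixed : ¬ (∀ i → P i ≡ 1ℙ) → ¬ (∀ i → P i ≡ 0ℙ) → mex l ≡ 2
  mex-mixed notAllOdd notAllEven = mex≡2 (∈-image 0ℙ notAllOdd) (∈-image 1ℙ notAllEven)
    λ 2∈l → let (i , 2≡) = image⁻ 2∈l in 2≢toℕ (P i) 2≡

module _ {n : ℕ} {p : Subset n} {x : Fin n} where

  ∉⇒lookup≡false : x ∉ p → lookup p x ≡ false
  ∉⇒lookup≡false x∉p = ¬-not (x∉p ∘ lookup⇒[]= x p)

  lookup≡false⇒∉ : lookup p x ≡ false → x ∉ p
  lookup≡false⇒∉ eq x∈p with () ← trans (sym ([]=⇒lookup x∈p)) eq

∣p∪⁅x⁆∣≡1+∣p∣ : ∀ {n} (p : Subset n) {x} → x ∉ p → ∣ p ∪ ⁅ x ⁆ ∣ ≡ suc ∣ p ∣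
∣p∪⁅x⁆∣≡1+∣p∣ (outside ∷ p) {zero}  _   = cong suc (cong ∣_∣ (∪-identityʳ p))
∣p∪⁅x⁆∣≡1+∣p∣ (inside  ∷ p) {zero}  x∉p = contradiction here x∉p
∣p∪⁅x⁆∣≡1+∣p∣ (outside ∷ p) {suc x} x∉p = ∣p∪⁅x⁆∣≡1+∣p∣ p (x∉p ∘ there)
∣p∪⁅x⁆∣≡1+∣p∣ (inside  ∷ p) {suc x} x∉p = cong suc (∣p∪⁅x⁆∣≡1+∣p∣ p (x∉p ∘ there))

∣p∣≡1+m⇒Nonempty : ∀ {n m} (p : Subset n) → ∣ p ∣ ≡ suc m → Nonempty p
∣p∣≡1+m⇒Nonempty {n} p ∣p∣≡1+m with nonempty? p
... | yes nonempty = nonempty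
... | no empty with () ← trans (sym ∣p∣≡1+m) (trans (cong ∣_∣ (Empty-unique empty)) (∣⊥∣≡0 n))

module _ {n : ℕ} (Δ : SimplicialComplex n) where

  IsMove : Subset n → Fin n → Set
  IsMove F v = v ∉ F × IsFace Δ (F ∪ ⁅ v ⁆)

  options : ℕ → Subset n → List ℕ
  options f F = map (λ v → grundyFuel Δ f (F ∪ ⁅ v ⁆)) (moves Δ F)

  private
    legal? : ∀ F v → Dec (T (not (lookup F v) ∧ face Δ (F ∪ ⁅ v ⁆)))
    legal? F v = T? (not (lookup F v) ∧ face Δ (F ∪ ⁅ v ⁆))

  ∈-options⁺ : ∀ f F {v} → IsMove F v → grundyFuel Δ f (F ∪ ⁅ v ⁆) ∈ₗ options f F
  ∈-options⁺ f F {v} (v∉F , face) = ∈-map⁺ _ (∈-filter⁺ (legal? F) (∈-allFin v)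
    (Equivalence.from T-∧ (Equivalence.from T-not-≡ (∉⇒lookup≡false v∉F) , face)))

  ∈-options⁻ : ∀ f F {x} → x ∈ₗ options f F →
               ∃[ v ] IsMove F v × x ≡ grundyFuel Δ f (F ∪ ⁅ v ⁆)
  ∈-options⁻ f F x∈ =
    let (v , v∈moves , x≡) = ∈-map⁻ _ x∈
        v∈legal = proj₂ (∈-filter⁻ (legal? F) {xs = allFin n} v∈moves)
        (lookup≡false , face) = Equivalence.to T-∧ v∈legal
    in v , (lookup≡false⇒∉ (Equivalence.to T-not-≡ lookup≡false) , face) , x≡

  move-size : ∀ {F v} → IsMove F v → ∣ F ∪ ⁅ v ⁆ ∣ ≡ suc ∣ F ∣
  move-size {F} = ∣p∪⁅x⁆∣≡1+∣p∣ F ∘ proj₁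

  move⇒∣F∣<n : ∀ {F v} → IsMove F v → ∣ F ∣ < n
  move⇒∣F∣<n {F} {v} move = subst (_≤ n) (move-size move) (∣p∣≤n (F ∪ ⁅ v ⁆))

module Components {n k : ℕ} (Δ : SimplicialComplex n) (part : Fin n → Fin k) where

  ⊥-componentFace : ∀ {i} → IsComponentFace Δ part i ⊥
  ⊥-componentFace = emptyFace Δ , λ v∈⊥ → contradiction v∈⊥ ∉⊥

  extend : ∀ {i F v} → IsComponentFace Δ part i F → IsMove Δ F v → part v ≡ i →
           IsComponentFace Δ part i (F ∪ ⁅ v ⁆)
  extend {F = F} {v} (_ , inPart) (_ , face) v∈i =
    face , λ w∈F∪v → inPart∪ (x∈p∪q⁻ F ⁅ v ⁆ w∈F∪v)
    where
    inPart∪ : ∀ {w} → w ∈ F ⊎ w ∈ ⁅ v ⁆ → part w ≡ _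
    inPart∪ (inj₁ w∈F) = inPart w∈F
    inPart∪ (inj₂ w∈v) rewrite x∈⁅y⁆⇒x≡y v w∈v = v∈i

  facet-or-move : ∀ {i F} → IsComponentFace Δ part i F →
                  IsComponentFacet Δ part i F ⊎ ∃[ v ] IsMove Δ F v × part v ≡ i
  facet-or-move {i} {F} cf
    with any? (λ v → (¬? (v ∈? F) ×-dec T? (face Δ (F ∪ ⁅ v ⁆))) ×-dec (part v ≟ᶠ i))
  ... | yes move = inj₂ move
  ... | no noMove = inj₁ (cf , λ v v∉F (face , inPart) →
          noMove (v , (v∉F , face) , inPart (x∈p∪q⁺ (inj₂ (x∈⁅x⁆ v)))))

  facet-above-slack : ∀ s {i F} → n ≤ s + ∣ F ∣ → IsComponentFace Δ part i F →
                      ∃[ G ] F ⊆ G × IsComponentFacet Δ part i G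
  facet-above-slack s n≤ cf with facet-or-move cf
  facet-above-slack s       _  cf | inj₁ facet = _ , ⊆-refl , facet
  facet-above-slack zero    n≤ cf | inj₂ (v , move , _) = contradiction (move⇒∣F∣<n Δ move) (≤⇒≯ n≤)
  facet-above-slack (suc s) {F = F} n≤ cf | inj₂ (v , move , v∈i) =
    let (G , F∪v⊆G , facet) = facet-above-slack s n≤′ (extend cf move v∈i)
    in G , ⊆-trans (p⊆p∪q ⁅ v ⁆) F∪v⊆G , facet
    where
    n≤′ : n ≤ s + ∣ F ∪ ⁅ v ⁆ ∣
    n≤′ rewrite move-size Δ move | +-suc s ∣ F ∣ = n≤

  facet-above : ∀ {i F} → IsComponentFace Δ part i F →
                ∃[ G ] F ⊆ G × IsComponentFacet Δ part i G
  facet-above {F = F} = facet-above-slack n (m≤m+n n ∣ F ∣)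

  move-componentFace : IsDisjointUnion Δ part → ∀ {i F v} → Nonempty F →
                       IsComponentFace Δ part i F → IsMove Δ F v →
                       IsComponentFace Δ part i (F ∪ ⁅ v ⁆)
  move-componentFace disjoint {i} {F} {v} (u , u∈F) cf@(_ , inPart) move@(_ , face) =
    extend cf move v∈i
    where
    v∈i : part v ≡ i
    v∈i = let (j , inPart′) = disjoint (F ∪ ⁅ v ⁆) face
          in trans (inPart′ (x∈p∪q⁺ (inj₂ (x∈⁅x⁆ v))))
                   (trans (sym (inPart′ (p⊆p∪q ⁅ v ⁆ u∈F))) (inPart u∈F))

module PureComponents {n k : ℕ} (Δ : SimplicialComplex n) (part : Fin n → Fin k)
  (d : Fin k → ℕ) (pure : ∀ i → IsPureComponentOfDim Δ part i (d i)) where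

  open Components Δ part

  componentFace-size≤ : ∀ {i F} → IsComponentFace Δ part i F → ∣ F ∣ ≤ suc (d i)
  componentFace-size≤ {i} {F} cf =
    let (G , F⊆G , facet) = facet-above cf
    in subst (∣ F ∣ ≤_) (pure i G facet) (p⊆q⇒∣p∣≤∣q∣ F⊆G)

  component-dim<n : ∀ i → d i < n
  component-dim<n i =
    let (G , _ , facet) = facet-above (⊥-componentFace {i})
    in subst (_≤ n) (pure i G facet) (∣p∣≤n G)

  component-nonempty : ∀ i → ∃[ v ] part v ≡ i
  component-nonempty i =
    let (G , _ , facet) = facet-above (⊥-componentFace {i})
        (v , v∈G) = ∣p∣≡1+m⇒Nonempty G (pure i G facet)
    in v , proj₂ (proj₁ facet) v∈G

  module _ (disjoint : IsDisjointUnion Δ part) where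

    no-move-from-full : ∀ {i F v} → Nonempty F → IsComponentFace Δ part i F →
                        ∣ F ∣ ≡ suc (d i) → ¬ IsMove Δ F v
    no-move-from-full ne cf full move = 1+n≰n (subst₂ _≤_ (move-size Δ move) (sym full)
      (componentFace-size≤ (move-componentFace disjoint ne cf move)))

    grundy-componentFace : ∀ {i F m f} → Nonempty F → IsComponentFace Δ part i F →
                           ∣ F ∣ + m ≡ suc (d i) → m ≤ f → grundyFuel Δ f F ≡ toℕ (parity m)
    grundy-componentFace {m = zero} {zero} _ _ _ _ = refl
    grundy-componentFace {F = F} {zero} {suc f} ne cf full _ = mex≡0 λ 0∈ →
      let (_ , move , _) = ∈-options⁻ Δ f F 0∈
      in no-move-from-full ne cf (trans (sym (+-identityʳ _)) full) move
    grundy-componentFace {i} {F} {suc m} {suc f} (u , u∈F) cf size (s≤s m≤f) =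
      trans (mex-constant (∈-options⁺ Δ f F (proj₂ someMove)) value) (cong toℕ (parity-suc m))
      where
      someMove : ∃[ v ] IsMove Δ F v
      someMove with facet-or-move cf
      ... | inj₁ facet = contradiction (trans size (sym (pure i F facet))) (m+1+n≢m ∣ F ∣)
      ... | inj₂ (v , move , _) = v , move

      size′ : ∀ {w} → IsMove Δ F w → ∣ F ∪ ⁅ w ⁆ ∣ + m ≡ suc (d i)
      size′ {w} move = begin
        ∣ F ∪ ⁅ w ⁆ ∣ + m ≡⟨ cong (_+ m) (move-size Δ move) ⟩
        suc ∣ F ∣ + m     ≡⟨ +-suc ∣ F ∣ m ⟨
        ∣ F ∣ + suc m     ≡⟨ size ⟩
        suc (d i)         ∎
        where open ≡-Reasoning

      value : ∀ {x} → x ∈ₗ options Δ f F → x ≡ toℕ (parity m)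
      value x∈ =
        let (w , move , x≡) = ∈-options⁻ Δ f F x∈
        in trans x≡ (grundy-componentFace (u , p⊆p∪q ⁅ w ⁆ u∈F)
                       (move-componentFace disjoint (u , u∈F) cf move) (size′ move) m≤f)

    vertex-move : ∀ {v} → IsMove Δ ⊥ v
    vertex-move {v} = ∉⊥ , subst (IsFace Δ) (sym (∪-identityˡ ⁅ v ⁆)) (vertexFace Δ v)

    grundy-vertex : ∀ {v} → grundyFuel Δ (pred n) (⊥ ∪ ⁅ v ⁆) ≡ toℕ (parity (d (part v)))
    grundy-vertex {v} =
      grundy-componentFace (v , x∈p∪q⁺ (inj₂ (x∈⁅x⁆ v)))
        (extend ⊥-componentFace vertex-move refl) size (<⇒≤pred (component-dim<n (part v)))
      where
      size : ∣ ⊥ ∪ ⁅ v ⁆ ∣ + d (part v) ≡ suc (d (part v))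
      size = cong (_+ d (part v)) (trans (move-size Δ vertex-move) (cong suc (∣⊥∣≡0 n)))

    rootOption⁻ : ∀ {x} → x ∈ₗ options Δ (pred n) ⊥ → ∃[ i ] x ≡ toℕ (parity (d i))
    rootOption⁻ x∈ =
      let (v , _ , x≡) = ∈-options⁻ Δ (pred n) ⊥ x∈ in part v , trans x≡ grundy-vertex

    rootOption⁺ : ∀ i → toℕ (parity (d i)) ∈ₗ options Δ (pred n) ⊥
    rootOption⁺ i =
      let (v , v∈i) = component-nonempty i
      in subst (λ j → toℕ (parity (d j)) ∈ₗ _) v∈i
           (subst (_∈ₗ _) grundy-vertex (∈-options⁺ Δ (pred n) ⊥ vertex-move))

mainTheorem16 : (n k : ℕ) → k ≥ 1 → (Δ : SimplicialComplex n) →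
    (part : Fin n → Fin k) → IsDisjointUnion Δ part →
    (d : Fin k → ℕ) → ((i : Fin k) → IsPureComponentOfDim Δ part i (d i)) →
    (((i : Fin k) → Odd (d i)) → gameValue Δ ≡ 0) ×
    (((i : Fin k) → Even (d i)) → gameValue Δ ≡ 1) ×
    (¬ ((i : Fin k) → Odd (d i)) → ¬ ((i : Fin k) → Even (d i)) →
       gameValue Δ ≡ 2)
mainTheorem16 _       zero    () _ _ _ _ _
mainTheorem16 zero    (suc k) _  Δ part _ d pure
  with (() , _) ← PureComponents.component-nonempty Δ part d pure zero
-- On suc n vertices, gameValue Δ unfolds to mex (options Δ n ⊥).
mainTheorem16 (suc n) (suc k) _  Δ part disjoint d pure = mex-allOdd , mex-allEven , mex-mixed
  where
  open PureComponents Δ part d pure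
  open ParityImage (parity ∘ d) (rootOption⁻ disjoint) (rootOption⁺ disjoint)
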